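{- Let $G$ be a finite group and let $H\leq A\leq G$. Suppose that $H$ is a perfect code of $G$. Then the following statements are equivalent: (a) $A$ is a perfect code of the pair $(G,H)$; (b) there exists an inverse-closed left transversal $X$ of $A$ in $G$ such that $XH=HX$; (c) for each $g\in G$, there exists an inverse-closed left transversal $Y$ of $A$ in $A\{g,g^{ -1}\}A$ such that $Y$ is a left transversal of $H$ in $HYH$.
   Context: All groups and graphs are finite; graphs are undirected and simple. A subset $C$ of the vertex set $V$ of a graph is a perfect code in the graph if every vertex in $V\setminus C$ is adjacent to exactly one vertex of $C$. For a group $G$ and an inverse-closed subset $S\subseteq G\setminus\{e\}$, the Cayley graph $\mathrm{Cay}(G,S)$ has vertex set $G$ and edges $\{g,sg\}$ for $s\in S$, $g\in G$. A subset of $G$ is a perfect code of $G$ if it is a perfect code in some Cayley graph of $G$. For $H\leq G$ and an inverse-closed subset $U\subseteq G\setminus H$, the coset graph $\mathrm{Cos}(G,H,U)$ has as vertices the left cosets of $H$ in $G$, with $xH$ and $yH$ adjacent iff $x^{ -1}y\in HUH$. For $H\leq A\leq G$, $A$ is a perfect code of the pair $(G,H)$ if there is a coset graph $\mathrm{Cos}(G,H,U)$ in which the set of left cosets of $H$ contained in $A$ is a perfect code. If $B$ is a union of left cosets of a subgroup $K$, a left transversal of $K$ in $B$ is a subset of $B$ containing exactly one element of each left coset of $K$ contained in $B$. A subset $X$ is inverse-closed if $X^{ -1}=X$. -}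

module Defs where

open import Data.Nat using (ℕ)
open import Data.Fin using (Fin)
open import Data.Fin.Subset using (Subset; _∈_; _∉_)
open import Data.Product using (Σ; ∃; ∃-syntax; _×_; _,_)
open import Data.Sum using (_⊎_)
open import Data.Unit using (⊤)
open import Relation.Nullary using (¬_)
open import Relation.Binary.PropositionalEquality using (_≡_)
open import Algebra.Structures using (IsGroup)
open import Level using (0ℓ)
open import Relation.Unary using (Pred)
open import Function.Bundles using (_⇔_)

-- A finite group: carrier Fin n (every finite group is isomorphic to one),
-- with propositional equality.
record FiniteGroup : Set where
  field
    n       : ℕ
    _∙_     : Fin n → Fin n → Fin n
    e       : Fin n
    _⁻¹     : Fin n → Fin n
    isGroup : IsGroup _≡_ _∙_ e _⁻¹

module _ (𝔾 : FiniteGroup) where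
  open FiniteGroup 𝔾

  G : Set
  G = Fin n

  IsSubgroup : Subset n → Set
  IsSubgroup H = (e ∈ H)
               × (∀ x y → x ∈ H → y ∈ H → (x ∙ y) ∈ H)
               × (∀ x → x ∈ H → (x ⁻¹) ∈ H)

  InverseClosed : Subset n → Set
  InverseClosed X = ∀ x → x ∈ X → (x ⁻¹) ∈ X

  CayAdj : Subset n → G → G → Set
  CayAdj S g h = (h ∙ (g ⁻¹)) ∈ S

  PerfectCodeInCay : Subset n → Subset n → Set
  PerfectCodeInCay S C =
    ∀ v → v ∉ C →
      (∃[ c ] (c ∈ C × CayAdj S v c))
      × (∀ c c′ → c ∈ C → c′ ∈ C → CayAdj S v c → CayAdj S v c′ → c ≡ c′)

  PerfectCodeOfGroup : Subset n → Set
  PerfectCodeOfGroup C =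
    ∃[ S ] (InverseClosed S × e ∉ S × PerfectCodeInCay S C)

  InDoubleProd : Subset n → Subset n → Subset n → Pred G 0ℓ
  InDoubleProd H U K z =
    ∃[ h₁ ] ∃[ u ] ∃[ h₂ ] (h₁ ∈ H × u ∈ U × h₂ ∈ K × z ≡ (h₁ ∙ u) ∙ h₂)

  -- Adjacency in Cos(G,H,U) between the cosets xH and yH: x⁻¹y ∈ HUH.
  CosAdj : Subset n → Subset n → G → G → Set
  CosAdj H U x y = InDoubleProd H U H ((x ⁻¹) ∙ y)

  CosetContainedIn : Subset n → Subset n → G → Set
  CosetContainedIn H A x = ∀ h → h ∈ H → (x ∙ h) ∈ A

  SameCoset : Subset n → G → G → Set
  SameCoset H x y = ((x ⁻¹) ∙ y) ∈ H

  PerfectCodeInCos : Subset n → Subset n → Subset n → Set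
  PerfectCodeInCos H U A =
    ∀ x → ¬ CosetContainedIn H A x →
      (∃[ y ] (CosetContainedIn H A y × CosAdj H U x y))
      × (∀ y y′ → CosetContainedIn H A y → CosetContainedIn H A y′ →
           CosAdj H U x y → CosAdj H U x y′ → SameCoset H y y′)

  PerfectCodeOfPair : Subset n → Subset n → Set
  PerfectCodeOfPair H A =
    ∃[ U ] (InverseClosed U × (∀ u → u ∈ U → u ∉ H) × PerfectCodeInCos H U A)

  LeftTransversal : Subset n → Pred G 0ℓ → Subset n → Set
  LeftTransversal K B T =
    (∀ t → t ∈ T → B t)
    × (∀ x → (∀ k → k ∈ K → B (x ∙ k)) →
         (∃[ t ] (t ∈ T × SameCoset K x t))
         × (∀ t t′ → t ∈ T → t′ ∈ T → SameCoset K x t → SameCoset K x t′ → t ≡ t′))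

  WholeGroup : Pred G 0ℓ
  WholeGroup _ = ⊤

  InProd : Subset n → Subset n → Pred G 0ℓ
  InProd X Y z = ∃[ x ] ∃[ y ] (x ∈ X × y ∈ Y × z ≡ x ∙ y)

  InAgA : Subset n → G → Pred G 0ℓ
  InAgA A g z =
    ∃[ a ] ∃[ s ] ∃[ a′ ] (a ∈ A × (s ≡ g ⊎ s ≡ g ⁻¹) × a′ ∈ A × z ≡ (a ∙ s) ∙ a′)

  CondB : Subset n → Subset n → Set
  CondB H A = ∃[ X ] (InverseClosed X × LeftTransversal A WholeGroup X
                      × (∀ z → InProd X H z ⇔ InProd H X z))

  CondC : Subset n → Subset n → Set
  CondC H A = ∀ g → ∃[ Y ] (InverseClosed Y × LeftTransversal A (InAgA A g) Y
                           × LeftTransversal H (InDoubleProd H Y H) Y)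

{-# OPTIONS --safe #-}
-- If H is a perfect code in Cay(G,S), then R = {e} ∪ (S ∖ H) is an inverse-closed left
-- transversal of H in G.
-- (a) ⇒ (b): for a witness Cos(G,H,U), the set Z = H ∪ (HUH ∖ A) is inverse-closed and a
-- union of left cosets of H, so X = R ∩ Z has XH = Z = Z⁻¹ = HX; the perfect-code property
-- of the cosets inside A makes X a left transversal of A.
-- (b) ⇒ (a): take U = X ∖ A, using HUH ⊆ HXH = XH.  (b) ⇒ (c): take Y = X ∩ A{g,g⁻¹}A.
-- (c) ⇒ (b): the sets A{g,g⁻¹}A partition G; gluing the sets Y(r) for one representative r
-- of each part gives X, and YH ⊆ HY holds because Y is a left transversal of H in HYH.
module Submission where

open import Defs
open import Data.Fin.Subset using (Subset; _⊆_)
open import Data.Product using (_×_)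
open import Function.Bundles using (_⇔_)

open import Algebra.Bundles using (Group)
open import Algebra.Structures using (IsGroup)
open import Data.Fin using (Fin; _≟_)
open import Data.Fin.Properties using (any?)
open import Data.Fin.Subset using (_∈_; _∉_; Nonempty)
open import Data.Fin.Subset.Properties using (_∈?_; nonempty?)
open import Data.Nat using (ℕ)
open import Data.Product using (∃-syntax; _,_; proj₁; proj₂)
open import Data.Sum using (_⊎_; inj₁; inj₂)
open import Data.Unit using (tt)
open import Data.Vec using (tabulate)
open import Data.Vec.Properties using ([]=⇒lookup; lookup⇒[]=; lookup∘tabulate; tabulate-cong)
open import Function using (_∘_)
open import Function.Bundles using (mk⇔; Equivalence)
open import Level using (0ℓ)
open import Relation.Nullary using (¬_; yes; no; does; contradiction)
open import Relation.Nullary.Decidable using (_×-dec_; _⊎-dec_; ¬?; dec-true; does-⇔)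
open import Relation.Unary using (Pred; Decidable)
open import Relation.Binary.PropositionalEquality
  using (_≡_; refl; sym; trans; cong; subst; module ≡-Reasoning)

module _ {m : ℕ} where

  fromDec : {P : Pred (Fin m) 0ℓ} → Decidable P → Subset m
  fromDec P? = tabulate (does ∘ P?)

  ∈-fromDec⁺ : {P : Pred (Fin m) 0ℓ} (P? : Decidable P) {x : Fin m} → P x → x ∈ fromDec P?
  ∈-fromDec⁺ P? {x} px =
    lookup⇒[]= x (fromDec P?) (trans (lookup∘tabulate (does ∘ P?) x) (dec-true (P? x) px))

  ∈-fromDec⁻ : {P : Pred (Fin m) 0ℓ} (P? : Decidable P) {x : Fin m} → x ∈ fromDec P? → P x
  ∈-fromDec⁻ P? {x} x∈ with P? x | trans (sym (lookup∘tabulate (does ∘ P?) x)) ([]=⇒lookup x∈)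
  ... | yes px | _  = px
  ... | no _   | ()

  fromDec-cong : {P Q : Pred (Fin m) 0ℓ} (P? : Decidable P) (Q? : Decidable Q) →
                 (∀ x → P x ⇔ Q x) → fromDec P? ≡ fromDec Q?
  fromDec-cong P? Q? P⇔Q = tabulate-cong (λ x → does-⇔ (P⇔Q x) (P? x) (Q? x))

  choose : (p : Subset m) → Nonempty p → Fin m
  choose p ne with nonempty? p
  ... | yes (x , _) = x
  ... | no  p-empty = contradiction ne p-empty

  choose-∈ : (p : Subset m) (ne : Nonempty p) → choose p ne ∈ p
  choose-∈ p ne with nonempty? p
  ... | yes (_ , x∈p) = x∈p
  ... | no  p-empty   = contradiction ne p-empty

  choose-cong : {p q : Subset m} → p ≡ q → (ne : Nonempty p) (ne′ : Nonempty q) →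
                choose p ne ≡ choose q ne′
  choose-cong {p} refl ne _ with nonempty? p
  ... | yes _       = refl
  ... | no  p-empty = contradiction ne p-empty

module _ (𝔾 : FiniteGroup) where
  open FiniteGroup 𝔾 renaming (_∙_ to infixl 7 _∙_; _⁻¹ to infix 8 _⁻¹)
  -- x \\ y = x ⁻¹ ∙ y, so SameCoset 𝔾 K x y is definitionally x \\ y ∈ K
  open IsGroup isGroup using (assoc; identityˡ; identityʳ; inverseˡ; _\\_; _//_)

  private
    group : Group 0ℓ 0ℓ
    group = record
      { Carrier = G 𝔾 ; _≈_ = _≡_ ; _∙_ = _∙_ ; ε = e ; _⁻¹ = _⁻¹ ; isGroup = isGroup }

  open import Algebra.Properties.Group group
    using ( ε⁻¹≈ε; ⁻¹-involutive; ⁻¹-injective; ⁻¹-anti-homo-∙; ⁻¹-anti-homo-//; ⁻¹-anti-homo-\\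
          ; \\-leftDividesˡ; \\-leftDividesʳ; //-rightDividesʳ; ∙-cancelʳ)

  \\-cancelˡ-∙ : ∀ a x y → (a ∙ x) \\ (a ∙ y) ≡ x \\ y
  \\-cancelˡ-∙ a x y = begin
    (a ∙ x) ⁻¹ ∙ (a ∙ y)     ≡⟨ cong (_∙ (a ∙ y)) (⁻¹-anti-homo-∙ a x) ⟩
    x ⁻¹ ∙ a ⁻¹ ∙ (a ∙ y)    ≡⟨ assoc (x ⁻¹) (a ⁻¹) (a ∙ y) ⟩
    x ⁻¹ ∙ (a \\ (a ∙ y))    ≡⟨ cong (x ⁻¹ ∙_) (\\-leftDividesʳ a y) ⟩
    x \\ y                   ∎
    where open ≡-Reasoning

  ⁻¹-anti-homo-∙∙ : ∀ x y z → (x ∙ y ∙ z) ⁻¹ ≡ z ⁻¹ ∙ y ⁻¹ ∙ x ⁻¹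
  ⁻¹-anti-homo-∙∙ x y z = begin
    (x ∙ y ∙ z) ⁻¹           ≡⟨ ⁻¹-anti-homo-∙ (x ∙ y) z ⟩
    z ⁻¹ ∙ (x ∙ y) ⁻¹        ≡⟨ cong (z ⁻¹ ∙_) (⁻¹-anti-homo-∙ x y) ⟩
    z ⁻¹ ∙ (y ⁻¹ ∙ x ⁻¹)     ≡⟨ assoc (z ⁻¹) (y ⁻¹) (x ⁻¹) ⟨
    z ⁻¹ ∙ y ⁻¹ ∙ x ⁻¹       ∎
    where open ≡-Reasoning

  MeetsCoset : Subset n → Subset n → G 𝔾 → Set
  MeetsCoset K X z = ∃[ t ] (t ∈ X × SameCoset 𝔾 K z t)

  InProd-⁻¹ : ∀ {X Y z} → InverseClosed 𝔾 X → InverseClosed 𝔾 Y →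
              InProd 𝔾 X Y z → InProd 𝔾 Y X (z ⁻¹)
  InProd-⁻¹ X⁻¹ Y⁻¹ (x , y , x∈X , y∈Y , refl) =
    y ⁻¹ , x ⁻¹ , Y⁻¹ y y∈Y , X⁻¹ x x∈X , ⁻¹-anti-homo-∙ x y

  InProd-commute : ∀ {X Y} → InverseClosed 𝔾 X → InverseClosed 𝔾 Y →
                   (∀ z → InProd 𝔾 X Y z → InProd 𝔾 Y X z) →
                   ∀ z → InProd 𝔾 X Y z ⇔ InProd 𝔾 Y X z
  InProd-commute {X} {Y} X⁻¹ Y⁻¹ XY⊆YX z = mk⇔ (XY⊆YX z) λ z∈YX →
    subst (InProd 𝔾 X Y) (⁻¹-involutive z)
      (InProd-⁻¹ Y⁻¹ X⁻¹ (XY⊆YX (z ⁻¹) (InProd-⁻¹ Y⁻¹ X⁻¹ z∈YX)))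

  module _ {K T : Subset n} (T-transversal : LeftTransversal 𝔾 K (WholeGroup 𝔾) T) where

    transversal-meets : ∀ x → MeetsCoset K T x
    transversal-meets x = proj₁ (proj₂ T-transversal x (λ _ _ → tt))

    transversal-unique : ∀ x t t′ → t ∈ T → t′ ∈ T →
                         SameCoset 𝔾 K x t → SameCoset 𝔾 K x t′ → t ≡ t′
    transversal-unique x = proj₂ (proj₂ T-transversal x (λ _ _ → tt))

  module Subgroup {K : Subset n} (K≤G : IsSubgroup 𝔾 K) where

    ε∈ : e ∈ K
    ε∈ = proj₁ K≤G

    ∙-closed : ∀ {x y} → x ∈ K → y ∈ K → x ∙ y ∈ K
    ∙-closed = proj₁ (proj₂ K≤G) _ _

    ⁻¹-closed : ∀ {x} → x ∈ K → x ⁻¹ ∈ K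
    ⁻¹-closed = proj₂ (proj₂ K≤G) _

    inverseClosed : InverseClosed 𝔾 K
    inverseClosed _ = ⁻¹-closed

    ∉-⁻¹ : ∀ {x} → x ∉ K → x ⁻¹ ∉ K
    ∉-⁻¹ {x} x∉K x⁻¹∈K = x∉K (subst (_∈ K) (⁻¹-involutive x) (⁻¹-closed x⁻¹∈K))

    sameCoset-refl : ∀ {x} → SameCoset 𝔾 K x x
    sameCoset-refl {x} = subst (_∈ K) (sym (inverseˡ x)) ε∈

    sameCoset-sym : ∀ {x y} → SameCoset 𝔾 K x y → SameCoset 𝔾 K y x
    sameCoset-sym {x} {y} p = subst (_∈ K) (⁻¹-anti-homo-\\ x y) (⁻¹-closed p)

    sameCoset-trans : ∀ {x y z} → SameCoset 𝔾 K x y → SameCoset 𝔾 K y z → SameCoset 𝔾 K x z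
    sameCoset-trans {x} {y} {z} p q =
      subst (_∈ K) (trans (assoc _ _ _) (cong (x ⁻¹ ∙_) (\\-leftDividesˡ y z))) (∙-closed p q)

    sameCoset-∙ʳ : ∀ {x k} → k ∈ K → SameCoset 𝔾 K x (x ∙ k)
    sameCoset-∙ʳ {x} {k} k∈K = subst (_∈ K) (sym (\\-leftDividesʳ x k)) k∈K

    ∈⇒sameCoset : ∀ {x y} → x ∈ K → y ∈ K → SameCoset 𝔾 K x y
    ∈⇒sameCoset x∈K y∈K = ∙-closed (⁻¹-closed x∈K) y∈K

    ∈-sameCoset : ∀ {x y} → x ∈ K → SameCoset 𝔾 K x y → y ∈ K
    ∈-sameCoset {x} {y} x∈K p = subst (_∈ K) (\\-leftDividesˡ x y) (∙-closed x∈K p)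

    ∉-sameCoset : ∀ {x y} → x ∉ K → SameCoset 𝔾 K x y → y ∉ K
    ∉-sameCoset x∉K p y∈K = x∉K (∈-sameCoset y∈K (sameCoset-sym p))

    InProd⇔meetsCoset : ∀ {X z} → InProd 𝔾 X K z ⇔ MeetsCoset K X z
    InProd⇔meetsCoset {X} {z} = mk⇔
      (λ { (x , k , x∈X , k∈K , refl) → x , x∈X , sameCoset-sym (sameCoset-∙ʳ k∈K) })
      (λ { (t , t∈X , p) → t , (z \\ t) ⁻¹ , t∈X , ⁻¹-closed p ,
             sym (trans (cong (t ∙_) (⁻¹-anti-homo-\\ z t)) (\\-leftDividesˡ t z)) })

    InDoubleProd? : ∀ U → Decidable (InDoubleProd 𝔾 K U K)
    InDoubleProd? U z = any? λ k → any? λ u → any? λ k′ →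
      (k ∈? K) ×-dec (u ∈? U) ×-dec (k′ ∈? K) ×-dec (z ≟ k ∙ u ∙ k′)

    ∈-doubleProd : ∀ {U u} → u ∈ U → InDoubleProd 𝔾 K U K u
    ∈-doubleProd {u = u} u∈U =
      e , u , e , ε∈ , u∈U , ε∈ , sym (trans (identityʳ _) (identityˡ u))

    doubleProd-sameCoset : ∀ {U z z′} → InDoubleProd 𝔾 K U K z → SameCoset 𝔾 K z z′ →
                           InDoubleProd 𝔾 K U K z′
    doubleProd-sameCoset {z′ = z′} (k , u , k′ , k∈K , u∈U , k′∈K , refl) p =
      k , u , k′ ∙ ((k ∙ u ∙ k′) \\ z′) , k∈K , u∈U , ∙-closed k′∈K p ,
      trans (sym (\\-leftDividesˡ (k ∙ u ∙ k′) z′)) (assoc (k ∙ u) k′ _)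

    doubleProd-⁻¹ : ∀ {U z} → InverseClosed 𝔾 U → InDoubleProd 𝔾 K U K z →
                    InDoubleProd 𝔾 K U K (z ⁻¹)
    doubleProd-⁻¹ U⁻¹ (k , u , k′ , k∈K , u∈U , k′∈K , refl) =
      k′ ⁻¹ , u ⁻¹ , k ⁻¹ , ⁻¹-closed k′∈K , U⁻¹ u u∈U , ⁻¹-closed k∈K , ⁻¹-anti-homo-∙∙ k u k′

    doubleProd⇒meetsCoset : ∀ {U X z} → U ⊆ X → (∀ w → InProd 𝔾 K X w → InProd 𝔾 X K w) →
                            InDoubleProd 𝔾 K U K z → MeetsCoset K X z
    doubleProd⇒meetsCoset U⊆X KX⊆XK (k , u , k′ , k∈K , u∈U , k′∈K , refl)
      with Equivalence.to InProd⇔meetsCoset (KX⊆XK (k ∙ u) (k , u , k∈K , U⊆X u∈U , refl))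
    ... | t , t∈X , p = t , t∈X , sameCoset-trans (sameCoset-sym (sameCoset-∙ʳ k′∈K)) p

    InAgA? : ∀ g → Decidable (InAgA 𝔾 K g)
    InAgA? g z = any? λ k → any? λ s → any? λ k′ →
      (k ∈? K) ×-dec ((s ≟ g) ⊎-dec (s ≟ g ⁻¹)) ×-dec (k′ ∈? K) ×-dec (z ≟ k ∙ s ∙ k′)

    InAgA-refl : ∀ {g} → InAgA 𝔾 K g g
    InAgA-refl {g} = e , g , e , ε∈ , inj₁ refl , ε∈ , sym (trans (identityʳ _) (identityˡ g))

    InAgA-∙ˡ : ∀ {g k z} → k ∈ K → InAgA 𝔾 K g z → InAgA 𝔾 K g (k ∙ z)
    InAgA-∙ˡ {k = k} k∈K (a , s , a′ , a∈K , s≡ , a′∈K , refl) =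
      k ∙ a , s , a′ , ∙-closed k∈K a∈K , s≡ , a′∈K ,
      trans (sym (assoc k (a ∙ s) a′)) (cong (_∙ a′) (sym (assoc k a s)))

    InAgA-∙ʳ : ∀ {g k z} → InAgA 𝔾 K g z → k ∈ K → InAgA 𝔾 K g (z ∙ k)
    InAgA-∙ʳ {k = k} (a , s , a′ , a∈K , s≡ , a′∈K , refl) k∈K =
      a , s , a′ ∙ k , a∈K , s≡ , ∙-closed a′∈K k∈K , assoc (a ∙ s) a′ k

    InAgA-⁻¹ : ∀ {g z} → InAgA 𝔾 K g z → InAgA 𝔾 K g (z ⁻¹)
    InAgA-⁻¹ {g} (a , s , a′ , a∈K , s≡ , a′∈K , refl) =
      a′ ⁻¹ , s ⁻¹ , a ⁻¹ , ⁻¹-closed a′∈K , ⁻¹-generator s≡ , ⁻¹-closed a∈K ,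
      ⁻¹-anti-homo-∙∙ a s a′
      where
      ⁻¹-generator : ∀ {s} → s ≡ g ⊎ s ≡ g ⁻¹ → s ⁻¹ ≡ g ⊎ s ⁻¹ ≡ g ⁻¹
      ⁻¹-generator (inj₁ refl) = inj₂ refl
      ⁻¹-generator (inj₂ refl) = inj₁ (⁻¹-involutive g)

    InAgA-sameCoset : ∀ {g z z′} → InAgA 𝔾 K g z → SameCoset 𝔾 K z z′ → InAgA 𝔾 K g z′
    InAgA-sameCoset {z = z} {z′} p q = subst (InAgA 𝔾 K _) (\\-leftDividesˡ z z′) (InAgA-∙ʳ p q)

    InAgA-generator : ∀ {g z s} → InAgA 𝔾 K g z → s ≡ z ⊎ s ≡ z ⁻¹ → InAgA 𝔾 K g s
    InAgA-generator p (inj₁ refl) = p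
    InAgA-generator p (inj₂ refl) = InAgA-⁻¹ p

    InAgA-trans : ∀ {g z w} → InAgA 𝔾 K g z → InAgA 𝔾 K z w → InAgA 𝔾 K g w
    InAgA-trans p (b , r , b′ , b∈K , r≡ , b′∈K , refl) =
      InAgA-∙ʳ (InAgA-∙ˡ b∈K (InAgA-generator p r≡)) b′∈K

    InAgA-sym : ∀ {g z} → InAgA 𝔾 K g z → InAgA 𝔾 K z g
    InAgA-sym {g} {z} (a , s , a′ , a∈K , s≡ , a′∈K , refl) =
      InAgA-generator z~s (generator-sym s≡)
      where
      s≡a\\z//a′ : a \\ (z // a′) ≡ s
      s≡a\\z//a′ = trans (cong (a \\_) (//-rightDividesʳ a′ (a ∙ s))) (\\-leftDividesʳ a s)
      z~s : InAgA 𝔾 K z s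
      z~s = subst (InAgA 𝔾 K z) s≡a\\z//a′
        (InAgA-∙ˡ (⁻¹-closed a∈K) (InAgA-∙ʳ InAgA-refl (⁻¹-closed a′∈K)))
      generator-sym : s ≡ g ⊎ s ≡ g ⁻¹ → g ≡ s ⊎ g ≡ s ⁻¹
      generator-sym (inj₁ refl) = inj₁ refl
      generator-sym (inj₂ refl) = inj₂ (sym (⁻¹-involutive g))

    InAgA-doubleProd : ∀ {L U g z} → L ⊆ K → (∀ {u} → u ∈ U → InAgA 𝔾 K g u) →
                       InDoubleProd 𝔾 L U L z → InAgA 𝔾 K g z
    InAgA-doubleProd L⊆K U⊆Kg (l , u , l′ , l∈L , u∈U , l′∈L , refl) =
      InAgA-∙ʳ (InAgA-∙ˡ (L⊆K l∈L) (U⊆Kg u∈U)) (L⊆K l′∈L)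

    doubleProdTransversal⇒YK⊆KY : ∀ {Y z} → InverseClosed 𝔾 Y →
      LeftTransversal 𝔾 K (InDoubleProd 𝔾 K Y K) Y → InProd 𝔾 Y K z → InProd 𝔾 K Y z
    doubleProdTransversal⇒YK⊆KY {Y} Y⁻¹ (_ , Y-transversal) (y , k , y∈Y , k∈K , refl) =
      subst (InProd 𝔾 K Y) (⁻¹-involutive (y ∙ k))
        (InProd-⁻¹ Y⁻¹ inverseClosed
          (Equivalence.from InProd⇔meetsCoset (proj₁ (Y-transversal ((y ∙ k) ⁻¹) z⁻¹K⊆KYK))))
      where
      z⁻¹K⊆KYK : ∀ k′ → k′ ∈ K → InDoubleProd 𝔾 K Y K ((y ∙ k) ⁻¹ ∙ k′)
      z⁻¹K⊆KYK k′ k′∈K =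
        k ⁻¹ , y ⁻¹ , k′ , ⁻¹-closed k∈K , Y⁻¹ y y∈Y , k′∈K , cong (_∙ k′) (⁻¹-anti-homo-∙ y k)

  module _ {H : Subset n} (H≤G : IsSubgroup 𝔾 H) where
    private module H = Subgroup H≤G

    module FromPerfectCode {S : Subset n} (S⁻¹ : InverseClosed 𝔾 S) (code : PerfectCodeInCay 𝔾 S H)
      where

      R? : Decidable (λ r → r ≡ e ⊎ (r ∈ S × r ∉ H))
      R? r = (r ≟ e) ⊎-dec ((r ∈? S) ×-dec ¬? (r ∈? H))

      R : Subset n
      R = fromDec R?

      R⁻¹ : InverseClosed 𝔾 R
      R⁻¹ r r∈R with ∈-fromDec⁻ R? r∈R
      ... | inj₁ refl          = ∈-fromDec⁺ R? (inj₁ ε⁻¹≈ε)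
      ... | inj₂ (r∈S , r∉H)   = ∈-fromDec⁺ R? (inj₂ (S⁻¹ r r∈S , H.∉-⁻¹ r∉H))

      R∩H≡e : ∀ {t} → t ∈ R → t ∈ H → t ≡ e
      R∩H≡e t∈R t∈H with ∈-fromDec⁻ R? t∈R
      ... | inj₁ t≡e       = t≡e
      ... | inj₂ (_ , t∉H) = contradiction t∈H t∉H

      R∖H⊆S : ∀ {t} → t ∈ R → t ∉ H → t ∈ S
      R∖H⊆S t∈R t∉H with ∈-fromDec⁻ R? t∈R
      ... | inj₁ refl      = contradiction H.ε∈ t∉H
      ... | inj₂ (t∈S , _) = t∈S

      R-meetsCoset : ∀ x → MeetsCoset H R x
      R-meetsCoset x with x ∈? H
      ... | yes x∈H = e , ∈-fromDec⁺ R? (inj₁ refl) , H.∈⇒sameCoset x∈H H.ε∈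
      ... | no  x∉H with proj₁ (code x x∉H)
      ... | c , c∈H , cx⁻¹∈S =
        x // c , ∈-fromDec⁺ R? (inj₂ (x//c∈S , H.∉-sameCoset x∉H x~t)) , x~t
        where
        x~t : SameCoset 𝔾 H x (x // c)
        x~t = H.sameCoset-∙ʳ (H.⁻¹-closed c∈H)
        x//c∈S : x // c ∈ S
        x//c∈S = subst (_∈ S) (⁻¹-anti-homo-// c x) (S⁻¹ _ cx⁻¹∈S)

      R-unique : ∀ x t t′ → t ∈ R → t′ ∈ R → SameCoset 𝔾 H x t → SameCoset 𝔾 H x t′ → t ≡ t′
      R-unique x t t′ t∈R t′∈R p p′ with x ∈? H
      ... | yes x∈H =
        trans (R∩H≡e t∈R (H.∈-sameCoset x∈H p)) (sym (R∩H≡e t′∈R (H.∈-sameCoset x∈H p′)))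
      ... | no  x∉H =
        ⁻¹-injective (∙-cancelʳ x (t ⁻¹) (t′ ⁻¹) (proj₂ (code x x∉H) (t \\ x) (t′ \\ x)
          (H.sameCoset-sym p) (H.sameCoset-sym p′) (adjacent t∈R p) (adjacent t′∈R p′)))
        where
        adjacent : ∀ {t} → t ∈ R → SameCoset 𝔾 H x t → CayAdj 𝔾 S x (t \\ x)
        adjacent {t} t∈R p =
          subst (_∈ S) (sym (//-rightDividesʳ x (t ⁻¹))) (S⁻¹ t (R∖H⊆S t∈R (H.∉-sameCoset x∉H p)))

      R-transversal : LeftTransversal 𝔾 H (WholeGroup 𝔾) R
      R-transversal = (λ _ _ → tt) , λ x _ → R-meetsCoset x , R-unique x

    perfectCode⇒transversal : PerfectCodeOfGroup 𝔾 H →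
      ∃[ R ] (InverseClosed 𝔾 R × LeftTransversal 𝔾 H (WholeGroup 𝔾) R)
    perfectCode⇒transversal (S , S⁻¹ , _ , code) = R , R⁻¹ , R-transversal
      where open FromPerfectCode S⁻¹ code

  module Equivalences {H A : Subset n} (H≤G : IsSubgroup 𝔾 H) (A≤G : IsSubgroup 𝔾 A) (H⊆A : H ⊆ A)
    where
    private
      module H = Subgroup H≤G
      module A = Subgroup A≤G

    cosetContainedIn⇒∈ : ∀ {x} → CosetContainedIn 𝔾 H A x → x ∈ A
    cosetContainedIn⇒∈ {x} xH⊆A = subst (_∈ A) (identityʳ x) (xH⊆A e H.ε∈)

    ∈⇒cosetContainedIn : ∀ {x} → x ∈ A → CosetContainedIn 𝔾 H A x
    ∈⇒cosetContainedIn x∈A _ h∈H = A.∙-closed x∈A (H⊆A h∈H)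

    ∉⇒¬cosetContainedIn : ∀ {x} → x ∉ A → ¬ CosetContainedIn 𝔾 H A x
    ∉⇒¬cosetContainedIn x∉A = x∉A ∘ cosetContainedIn⇒∈

    module FromPerfectCodeOfPair
      {R U : Subset n}
      (R⁻¹ : InverseClosed 𝔾 R) (R-transversal : LeftTransversal 𝔾 H (WholeGroup 𝔾) R)
      (U⁻¹ : InverseClosed 𝔾 U) (code : PerfectCodeInCos 𝔾 H U A)
      where

      Z : G 𝔾 → Set
      Z z = z ∈ H ⊎ (z ∉ A × InDoubleProd 𝔾 H U H z)

      Z? : Decidable Z
      Z? z = (z ∈? H) ⊎-dec (¬? (z ∈? A) ×-dec H.InDoubleProd? U z)

      Z-sameCoset : ∀ {z z′} → Z z → SameCoset 𝔾 H z z′ → Z z′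
      Z-sameCoset (inj₁ z∈H) p = inj₁ (H.∈-sameCoset z∈H p)
      Z-sameCoset (inj₂ (z∉A , z∈HUH)) p =
        inj₂ (A.∉-sameCoset z∉A (H⊆A p) , H.doubleProd-sameCoset z∈HUH p)

      Z-⁻¹ : ∀ {z} → Z z → Z (z ⁻¹)
      Z-⁻¹ (inj₁ z∈H)            = inj₁ (H.⁻¹-closed z∈H)
      Z-⁻¹ (inj₂ (z∉A , z∈HUH)) = inj₂ (A.∉-⁻¹ z∉A , H.doubleProd-⁻¹ U⁻¹ z∈HUH)

      X? : Decidable (λ x → x ∈ R × Z x)
      X? x = (x ∈? R) ×-dec Z? x

      X : Subset n
      X = fromDec X?

      X⁻¹ : InverseClosed 𝔾 X
      X⁻¹ x x∈X with ∈-fromDec⁻ X? x∈X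
      ... | x∈R , Zx = ∈-fromDec⁺ X? (R⁻¹ x x∈R , Z-⁻¹ Zx)

      XH⇔Z : ∀ {z} → InProd 𝔾 X H z ⇔ Z z
      XH⇔Z {z} = mk⇔
        (λ z∈XH → let t , t∈X , p = Equivalence.to H.InProd⇔meetsCoset z∈XH
                  in Z-sameCoset (proj₂ (∈-fromDec⁻ X? t∈X)) (H.sameCoset-sym p))
        (λ Zz → let t , t∈R , p = transversal-meets R-transversal z
                in Equivalence.from H.InProd⇔meetsCoset
                     (t , ∈-fromDec⁺ X? (t∈R , Z-sameCoset Zz p) , p))

      XH⊆HX : ∀ z → InProd 𝔾 X H z → InProd 𝔾 H X z
      XH⊆HX z z∈XH = subst (InProd 𝔾 H X) (⁻¹-involutive z)
        (InProd-⁻¹ X⁻¹ H.inverseClosed (Equivalence.from XH⇔Z (Z-⁻¹ (Equivalence.to XH⇔Z z∈XH))))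

      Z⇒meetsCoset : ∀ {z} → Z z → MeetsCoset H X z
      Z⇒meetsCoset = Equivalence.to H.InProd⇔meetsCoset ∘ Equivalence.from XH⇔Z

      X-meetsCoset : ∀ x → MeetsCoset A X x
      X-meetsCoset x with x ∈? A
      ... | yes x∈A =
        let t , t∈X , p = Z⇒meetsCoset (inj₁ H.ε∈)
        in t , t∈X , A.∈⇒sameCoset x∈A (H⊆A (H.∈-sameCoset H.ε∈ p))
      ... | no  x∉A
        with proj₁ (code (x ⁻¹) (∉⇒¬cosetContainedIn (A.∉-⁻¹ x∉A)))
      ... | y , yH⊆A , x⁻¹yH⊆HUH =
        let t , t∈X , p = Z⇒meetsCoset (inj₂ (A.∉-sameCoset x∉A x~w , x⁻¹yH⊆HUH))
        in t , t∈X , A.sameCoset-trans x~w (H⊆A p)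
        where
        x~w : SameCoset 𝔾 A x (x ⁻¹ \\ y)
        x~w = subst (_∈ A) (sym (\\-leftDividesˡ (x ⁻¹) y)) (cosetContainedIn⇒∈ yH⊆A)

      X-sameCoset : ∀ {t t′} → t ∈ X → t′ ∈ X → SameCoset 𝔾 A t t′ → SameCoset 𝔾 H t t′
      X-sameCoset {t} {t′} t∈X t′∈X p with proj₂ (∈-fromDec⁻ X? t∈X) | proj₂ (∈-fromDec⁻ X? t′∈X)
      ... | inj₁ t∈H       | inj₁ t′∈H       = H.∈⇒sameCoset t∈H t′∈H
      ... | inj₁ t∈H       | inj₂ (t′∉A , _) = contradiction (A.∈-sameCoset (H⊆A t∈H) p) t′∉A
      ... | inj₂ (t∉A , _) | inj₁ t′∈H       =
        contradiction (A.∈-sameCoset (H⊆A t′∈H) (A.sameCoset-sym p)) t∉A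
      ... | inj₂ (t∉A , t∈HUH) | inj₂ (_ , t′∈HUH) =
        -- eH and t⁻¹t′H lie in A and are both adjacent to t⁻¹H, so they are the same coset
        H.∈-sameCoset H.ε∈ (proj₂ (code (t ⁻¹) (∉⇒¬cosetContainedIn (A.∉-⁻¹ t∉A)))
          e (t \\ t′) (∈⇒cosetContainedIn A.ε∈) (∈⇒cosetContainedIn p) t⁻¹H~eH t⁻¹H~t⁻¹t′H)
        where
        t⁻¹H~eH : CosAdj 𝔾 H U (t ⁻¹) e
        t⁻¹H~eH = subst (InDoubleProd 𝔾 H U H) (sym (trans (identityʳ _) (⁻¹-involutive t))) t∈HUH
        t⁻¹H~t⁻¹t′H : CosAdj 𝔾 H U (t ⁻¹) (t \\ t′)
        t⁻¹H~t⁻¹t′H = subst (InDoubleProd 𝔾 H U H) (sym (\\-leftDividesʳ (t ⁻¹) t′)) t′∈HUH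

      X-transversal : LeftTransversal 𝔾 A (WholeGroup 𝔾) X
      X-transversal = (λ _ _ → tt) , λ x _ → X-meetsCoset x , unique x
        where
        unique : ∀ x t t′ → t ∈ X → t′ ∈ X → SameCoset 𝔾 A x t → SameCoset 𝔾 A x t′ → t ≡ t′
        unique x t t′ t∈X t′∈X p p′ =
          transversal-unique R-transversal t t t′
            (proj₁ (∈-fromDec⁻ X? t∈X)) (proj₁ (∈-fromDec⁻ X? t′∈X)) H.sameCoset-refl
            (X-sameCoset t∈X t′∈X (A.sameCoset-trans (A.sameCoset-sym p) p′))

    module FromCondB
      {X : Subset n}
      (X⁻¹ : InverseClosed 𝔾 X) (X-transversal : LeftTransversal 𝔾 A (WholeGroup 𝔾) X)
      (HX⊆XH : ∀ z → InProd 𝔾 H X z → InProd 𝔾 X H z)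
      where

      U? : Decidable (λ u → u ∈ X × u ∉ A)
      U? u = (u ∈? X) ×-dec ¬? (u ∈? A)

      U : Subset n
      U = fromDec U?

      U⁻¹ : InverseClosed 𝔾 U
      U⁻¹ u u∈U with ∈-fromDec⁻ U? u∈U
      ... | u∈X , u∉A = ∈-fromDec⁺ U? (X⁻¹ u u∈X , A.∉-⁻¹ u∉A)

      U∩H≡∅ : ∀ u → u ∈ U → u ∉ H
      U∩H≡∅ u u∈U u∈H = proj₂ (∈-fromDec⁻ U? u∈U) (H⊆A u∈H)

      x⁻¹A-meets : ∀ {x y v} → y ∈ A → SameCoset 𝔾 H (x \\ y) v → SameCoset 𝔾 A (x ⁻¹) v
      x⁻¹A-meets {x} {y} y∈A p =
        A.sameCoset-trans (subst (_∈ A) (sym (\\-leftDividesʳ (x ⁻¹) y)) y∈A) (H⊆A p)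

      U-perfectCode : PerfectCodeInCos 𝔾 H U A
      U-perfectCode x xH⊈A = exists , unique
        where
        exists : ∃[ y ] (CosetContainedIn 𝔾 H A y × CosAdj 𝔾 H U x y)
        exists with transversal-meets X-transversal (x ⁻¹)
        ... | t , t∈X , p =
          x ⁻¹ \\ t , ∈⇒cosetContainedIn p ,
          subst (InDoubleProd 𝔾 H U H) (sym (\\-leftDividesˡ (x ⁻¹) t))
            (H.∈-doubleProd (∈-fromDec⁺ U? (t∈X , A.∉-sameCoset x⁻¹∉A p)))
          where
          x⁻¹∉A : x ⁻¹ ∉ A
          x⁻¹∉A = A.∉-⁻¹ (xH⊈A ∘ ∈⇒cosetContainedIn)

        unique : ∀ y y′ → CosetContainedIn 𝔾 H A y → CosetContainedIn 𝔾 H A y′ →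
                 CosAdj 𝔾 H U x y → CosAdj 𝔾 H U x y′ → SameCoset 𝔾 H y y′
        unique y y′ yH⊆A y′H⊆A adj adj′
          with H.doubleProd⇒meetsCoset (proj₁ ∘ ∈-fromDec⁻ U?) HX⊆XH adj
             | H.doubleProd⇒meetsCoset (proj₁ ∘ ∈-fromDec⁻ U?) HX⊆XH adj′
        ... | v , v∈X , p | v′ , v′∈X , p′
          with transversal-unique X-transversal (x ⁻¹) v v′ v∈X v′∈X
                 (x⁻¹A-meets (cosetContainedIn⇒∈ yH⊆A) p)
                 (x⁻¹A-meets (cosetContainedIn⇒∈ y′H⊆A) p′)
        ... | refl =
          subst (_∈ H) (\\-cancelˡ-∙ (x ⁻¹) y y′) (H.sameCoset-trans p (H.sameCoset-sym p′))

      module _ (g : G 𝔾) where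

        Y? : Decidable (λ y → y ∈ X × InAgA 𝔾 A g y)
        Y? y = (y ∈? X) ×-dec A.InAgA? g y

        Y : Subset n
        Y = fromDec Y?

        Y⊆X : Y ⊆ X
        Y⊆X = proj₁ ∘ ∈-fromDec⁻ Y?

        Y⊆AgA : ∀ {y} → y ∈ Y → InAgA 𝔾 A g y
        Y⊆AgA = proj₂ ∘ ∈-fromDec⁻ Y?

        Y⁻¹ : InverseClosed 𝔾 Y
        Y⁻¹ y y∈Y = ∈-fromDec⁺ Y? (X⁻¹ y (Y⊆X y∈Y) , A.InAgA-⁻¹ (Y⊆AgA y∈Y))

        Y-unique : ∀ {K} → K ⊆ A → ∀ x t t′ → t ∈ Y → t′ ∈ Y →
                   SameCoset 𝔾 K x t → SameCoset 𝔾 K x t′ → t ≡ t′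
        Y-unique K⊆A x t t′ t∈Y t′∈Y p p′ =
          transversal-unique X-transversal x t t′ (Y⊆X t∈Y) (Y⊆X t′∈Y) (K⊆A p) (K⊆A p′)

        Y-A-transversal : LeftTransversal 𝔾 A (InAgA 𝔾 A g) Y
        Y-A-transversal = (λ _ → Y⊆AgA) , λ x xA⊆AgA → meets x xA⊆AgA , Y-unique (λ a∈A → a∈A) x
          where
          meets : ∀ x → (∀ a → a ∈ A → InAgA 𝔾 A g (x ∙ a)) → MeetsCoset A Y x
          meets x xA⊆AgA with transversal-meets X-transversal x
          ... | t , t∈X , p =
            t , ∈-fromDec⁺ Y? (t∈X , subst (InAgA 𝔾 A g) (\\-leftDividesˡ x t) (xA⊆AgA _ p)) , p

        Y-H-transversal : LeftTransversal 𝔾 H (InDoubleProd 𝔾 H Y H) Y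
        Y-H-transversal = (λ _ → H.∈-doubleProd) , λ x xH⊆HYH → meets x xH⊆HYH , Y-unique H⊆A x
          where
          meets : ∀ x → (∀ h → h ∈ H → InDoubleProd 𝔾 H Y H (x ∙ h)) → MeetsCoset H Y x
          meets x xH⊆HYH = toY (H.doubleProd⇒meetsCoset Y⊆X HX⊆XH x∈HYH)
            where
            x∈HYH : InDoubleProd 𝔾 H Y H x
            x∈HYH = subst (InDoubleProd 𝔾 H Y H) (identityʳ x) (xH⊆HYH e H.ε∈)
            toY : MeetsCoset H X x → MeetsCoset H Y x
            toY (t , t∈X , p) = t , ∈-fromDec⁺ Y? (t∈X , t∈AgA) , p
              where
              t∈AgA : InAgA 𝔾 A g t
              t∈AgA = A.InAgA-sameCoset (A.InAgA-doubleProd H⊆A Y⊆AgA x∈HYH) (H⊆A p)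

    module FromCondC (Y-family : CondC 𝔾 H A) where

      Y : G 𝔾 → Subset n
      Y g = proj₁ (Y-family g)

      Y⁻¹ : ∀ g → InverseClosed 𝔾 (Y g)
      Y⁻¹ g = proj₁ (proj₂ (Y-family g))

      Y-A-transversal : ∀ g → LeftTransversal 𝔾 A (InAgA 𝔾 A g) (Y g)
      Y-A-transversal g = proj₁ (proj₂ (proj₂ (Y-family g)))

      Y-H-transversal : ∀ g → LeftTransversal 𝔾 H (InDoubleProd 𝔾 H (Y g) H) (Y g)
      Y-H-transversal g = proj₂ (proj₂ (proj₂ (Y-family g)))

      class : G 𝔾 → Subset n
      class g = fromDec (A.InAgA? g)

      rep : G 𝔾 → G 𝔾
      rep g = choose (class g) (g , ∈-fromDec⁺ (A.InAgA? g) A.InAgA-refl)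

      rep-related : ∀ g → InAgA 𝔾 A g (rep g)
      rep-related g = ∈-fromDec⁻ (A.InAgA? g) (choose-∈ (class g) _)

      rep-cong : ∀ {g z} → InAgA 𝔾 A g z → rep g ≡ rep z
      rep-cong {g} {z} g~z = choose-cong
        (fromDec-cong (A.InAgA? g) (A.InAgA? z)
          (λ w → mk⇔ (A.InAgA-trans (A.InAgA-sym g~z)) (A.InAgA-trans g~z)))
        _ _

      X? : Decidable (λ x → x ∈ Y (rep x))
      X? x = x ∈? Y (rep x)

      X : Subset n
      X = fromDec X?

      Y⊆X : ∀ g → Y (rep g) ⊆ X
      Y⊆X g {y} y∈Y = ∈-fromDec⁺ X? (subst (λ r → y ∈ Y r) (rep-cong g~y) y∈Y)
        where
        g~y : InAgA 𝔾 A g y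
        g~y = A.InAgA-trans (rep-related g) (proj₁ (Y-A-transversal (rep g)) y y∈Y)

      X⊆Y : ∀ {g x} → InAgA 𝔾 A g x → x ∈ X → x ∈ Y (rep g)
      X⊆Y {x = x} g~x x∈X = subst (λ r → x ∈ Y r) (sym (rep-cong g~x)) (∈-fromDec⁻ X? x∈X)

      X⁻¹ : InverseClosed 𝔾 X
      X⁻¹ x x∈X = Y⊆X x (Y⁻¹ (rep x) x (∈-fromDec⁻ X? x∈X))

      xA⊆class : ∀ x a → a ∈ A → InAgA 𝔾 A (rep x) (x ∙ a)
      xA⊆class x a a∈A = A.InAgA-∙ʳ (A.InAgA-sym (rep-related x)) a∈A

      X-transversal : LeftTransversal 𝔾 A (WholeGroup 𝔾) X
      X-transversal = (λ _ _ → tt) , λ x _ → meets x , unique x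
        where
        meets : ∀ x → MeetsCoset A X x
        meets x with proj₁ (proj₂ (Y-A-transversal (rep x)) x (xA⊆class x))
        ... | t , t∈Y , p = t , Y⊆X x t∈Y , p

        unique : ∀ x t t′ → t ∈ X → t′ ∈ X → SameCoset 𝔾 A x t → SameCoset 𝔾 A x t′ → t ≡ t′
        unique x t t′ t∈X t′∈X p p′ =
          proj₂ (proj₂ (Y-A-transversal (rep x)) x (xA⊆class x)) t t′
            (X⊆Y (A.InAgA-sameCoset A.InAgA-refl p) t∈X)
            (X⊆Y (A.InAgA-sameCoset A.InAgA-refl p′) t′∈X) p p′

      XH⊆HX : ∀ z → InProd 𝔾 X H z → InProd 𝔾 H X z
      XH⊆HX z (x , h , x∈X , h∈H , z≡xh)
        with H.doubleProdTransversal⇒YK⊆KY (Y⁻¹ (rep x)) (Y-H-transversal (rep x))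
               (x , h , ∈-fromDec⁻ X? x∈X , h∈H , z≡xh)
      ... | h′ , y , h′∈H , y∈Y , z≡h′y = h′ , y , h′∈H , Y⊆X x y∈Y , z≡h′y

    perfectCodeOfPair⇒condB : PerfectCodeOfGroup 𝔾 H → PerfectCodeOfPair 𝔾 H A → CondB 𝔾 H A
    perfectCodeOfPair⇒condB H-code (U , U⁻¹ , _ , code)
      with perfectCode⇒transversal H≤G H-code
    ... | R , R⁻¹ , R-transversal =
      X , X⁻¹ , X-transversal , InProd-commute X⁻¹ H.inverseClosed XH⊆HX
      where open FromPerfectCodeOfPair R⁻¹ R-transversal U⁻¹ code

    condB⇒perfectCodeOfPair : CondB 𝔾 H A → PerfectCodeOfPair 𝔾 H A
    condB⇒perfectCodeOfPair (X , X⁻¹ , X-transversal , XH⇔HX) = U , U⁻¹ , U∩H≡∅ , U-perfectCode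
      where open FromCondB X⁻¹ X-transversal (λ z → Equivalence.from (XH⇔HX z))

    condB⇒condC : CondB 𝔾 H A → CondC 𝔾 H A
    condB⇒condC (X , X⁻¹ , X-transversal , XH⇔HX) g =
      Y g , Y⁻¹ g , Y-A-transversal g , Y-H-transversal g
      where open FromCondB X⁻¹ X-transversal (λ z → Equivalence.from (XH⇔HX z))

    condC⇒condB : CondC 𝔾 H A → CondB 𝔾 H A
    condC⇒condB Y-family = X , X⁻¹ , X-transversal , InProd-commute X⁻¹ H.inverseClosed XH⊆HX
      where open FromCondC Y-family

theorem1p6 : (𝔾 : FiniteGroup) (H A : Subset (FiniteGroup.n 𝔾)) →
    IsSubgroup 𝔾 H → IsSubgroup 𝔾 A → H ⊆ A →
    PerfectCodeOfGroup 𝔾 H →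
    (PerfectCodeOfPair 𝔾 H A ⇔ CondB 𝔾 H A) × (PerfectCodeOfPair 𝔾 H A ⇔ CondC 𝔾 H A)
theorem1p6 𝔾 H A H≤G A≤G H⊆A H-code =
  mk⇔ (perfectCodeOfPair⇒condB H-code) condB⇒perfectCodeOfPair ,
  mk⇔ (condB⇒condC ∘ perfectCodeOfPair⇒condB H-code) (condB⇒perfectCodeOfPair ∘ condC⇒condB)
  where open Equivalences 𝔾 H≤G A≤G H⊆A
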